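{- Let $n\geq 2$ and $\ell\in\{1,\dots,\lfloor n/2\rfloor\}$, and let $$T(\ell)=\Big\{u\in\{0,1\}^n:\ \sum_{i=1}^n u_i<\ell\ \text{ or }\ \sum_{i=1}^n u_i>n-\ell\Big\}.$$ Then there exist $\ell$ hyperplanes $H_1,\dots,H_\ell$ in $\mathbb{R}^n$ such that $(H_1\cup\dots\cup H_\ell)\cap\{0,1\}^n=T(\ell)$, i.e. they cover every point of $T(\ell)$ and no other point of $\{0,1\}^n$.
   Context: A hyperplane is a set $\{x\in\mathbb{R}^n:\langle a,x\rangle=b\}$ with $a\in\mathbb{R}^n\setminus\{0\}$, $b\in\mathbb{R}$. -}

module Defs where

open import Data.Nat using (ℕ; zero; suc; _+_; _<_; _∸_)
open import Data.Fin using (Fin; zero; suc)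
open import Data.Bool using (Bool; true; false; if_then_else_)
open import Data.Rational using (ℚ; 0ℚ) renaming (_+_ to _+ℚ_)
open import Data.Sum using (_⊎_)
open import Relation.Binary.PropositionalEquality using (_≡_)
open import Relation.Nullary using (¬_)

-- A point of the cube {0,1}^n : true = 1, false = 0.
Cube : ℕ → Set
Cube n = Fin n → Bool

weight : ∀ {n} → Cube n → ℕ
weight {zero}  u = 0
weight {suc n} u = (if u zero then 1 else 0) + weight (λ i → u (suc i))

dot : ∀ {n} → (Fin n → ℚ) → Cube n → ℚ
dot {zero}  a u = 0ℚ
dot {suc n} a u = (if u zero then a zero else 0ℚ) +ℚ dot (λ i → a (suc i)) (λ i → u (suc i))

record Hyperplane (n : ℕ) : Set where
  field
    a       : Fin n → ℚ
    b       : ℚ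
    nonzero : ¬ (∀ i → a i ≡ 0ℚ)

_∈H_ : ∀ {n} → Cube n → Hyperplane n → Set
u ∈H H = dot (Hyperplane.a H) u ≡ Hyperplane.b H

T : (n ℓ : ℕ) → Cube n → Set
T n ℓ u = weight u < ℓ ⊎ n ∸ ℓ < weight u

-- Peel off the first coordinate x₀ and write x = (x₀, y). The hyperplane
-- −(n − 2ℓ + 1)·x₀ + Σ yᵢ = ℓ − 1 meets the cube exactly in the points with
-- x₀ = 0, |y| = ℓ − 1 and those with x₀ = 1, |y| = n − ℓ; these are precisely
-- the points of T(n, ℓ) whose tail y is not in T(n − 1, ℓ − 1). By induction
-- the latter is cut out by ℓ − 1 hyperplanes, which do not involve x₀.
module Submission where

open import Defs
open import Data.Nat using (ℕ; _≤_; ⌊_/2⌋)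
open import Data.Product using (Σ; _×_)
open import Data.Vec using (Vec)
open import Data.Vec.Relation.Unary.Any using (Any)

open import Data.Bool using (true; false; if_then_else_)
open import Data.Empty using (⊥-elim)
open import Data.Fin using (zero; suc)
open import Data.Nat using (zero; suc; _+_; _∸_; _<_; z≤n; s≤s)
open import Data.Nat.Properties
  using (≤-trans; m≤n⇒m≤1+n; +-comm; +-suc; +-monoʳ-≤; n≤1+n; n<1+n; m<n⇒m<1+n; m<1+n⇒m<n∨m≡n;
         <⇒≱; m+n≤o⇒m≤o∸n; m∸n+n≡m; ⌊n/2⌋≤⌈n/2⌉; ⌊n/2⌋+⌈n/2⌉≡n; +-mono-≤)
open import Data.Product using (_,_)
open import Data.Rational as ℚ using (ℚ; 0ℚ; 1ℚ; -_) renaming (_+_ to _+ℚ_)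
import Data.Rational.Properties as QP
open import Algebra.Properties.Group QP.+-0-group using (∙-cancelˡ; \\-leftDividesˡ; \\-leftDividesʳ)
open import Data.Sum using (_⊎_; inj₁; inj₂)
open import Data.Sum.Function.Propositional using (_⊎-⇔_)
open import Data.Vec using ([]; _∷_; map)
import Data.Vec.Functional as Vector
import Data.Vec.Relation.Unary.Any as Any
open import Data.Vec.Relation.Unary.Any.Properties using (map⁺; map⁻; ∷↔)
open import Function using (_∘_)
open import Function.Bundles using (_⇔_; mk⇔; Equivalence)
open import Function.Related.Propositional using (module EquationalReasoning)
open import Function.Construct.Identity using (⇔-id)
open import Function.Construct.Symmetry using (⇔-sym)
open import Relation.Binary.PropositionalEquality
  using (_≡_; refl; sym; trans; cong; subst; module ≡-Reasoning)
open import Relation.Nullary using (¬_)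

fromℕ : ℕ → ℚ
fromℕ zero    = 0ℚ
fromℕ (suc n) = 1ℚ +ℚ fromℕ n

fromℕ-+ : ∀ m n → fromℕ (m + n) ≡ fromℕ m +ℚ fromℕ n
fromℕ-+ zero    n = sym (QP.+-identityˡ (fromℕ n))
fromℕ-+ (suc m) n = trans (cong (1ℚ +ℚ_) (fromℕ-+ m n)) (sym (QP.+-assoc 1ℚ (fromℕ m) (fromℕ n)))

fromℕ-nonNeg : ∀ n → 0ℚ ℚ.≤ fromℕ n
fromℕ-suc-pos : ∀ n → 0ℚ ℚ.< fromℕ (suc n)

fromℕ-nonNeg zero    = QP.≤-refl
fromℕ-nonNeg (suc n) = QP.<⇒≤ (fromℕ-suc-pos n)

fromℕ-suc-pos n = QP.+-mono-<-≤ (QP.positive⁻¹ 1ℚ) (fromℕ-nonNeg n)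

fromℕ-injective : ∀ {m n} → fromℕ m ≡ fromℕ n → m ≡ n
fromℕ-injective {zero}  {zero}  _ = refl
fromℕ-injective {zero}  {suc n} e = ⊥-elim (QP.<⇒≢ (fromℕ-suc-pos n) e)
fromℕ-injective {suc m} {zero}  e = ⊥-elim (QP.<⇒≢ (fromℕ-suc-pos m) (sym e))
fromℕ-injective {suc m} {suc n} e = cong suc (fromℕ-injective (∙-cancelˡ 1ℚ (fromℕ m) (fromℕ n) e))

dot-1≡weight : ∀ {n} (v : Cube n) → dot (λ _ → 1ℚ) v ≡ fromℕ (weight v)
dot-1≡weight {zero}  v = refl
dot-1≡weight {suc n} v with v zero
... | true  = cong (1ℚ +ℚ_) (dot-1≡weight (Vector.tail v))
... | false = trans (QP.+-identityˡ _) (dot-1≡weight (Vector.tail v))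

weight≤n : ∀ {n} (v : Cube n) → weight v ≤ n
weight≤n {zero}  v = z≤n
weight≤n {suc n} v with v zero
... | true  = s≤s (weight≤n (Vector.tail v))
... | false = m≤n⇒m≤1+n (weight≤n (Vector.tail v))

T-zero-empty : ∀ {n} (u : Cube n) → ¬ T n 0 u
T-zero-empty u (inj₂ n<weight) = <⇒≱ n<weight (weight≤n u)

m≤⌊n/2⌋⇒m+m≤n : ∀ {m n} → m ≤ ⌊ n /2⌋ → m + m ≤ n
m≤⌊n/2⌋⇒m+m≤n {m} {n} m≤⌊n/2⌋ = subst (m + m ≤_) (⌊n/2⌋+⌈n/2⌉≡n n)
  (+-mono-≤ m≤⌊n/2⌋ (≤-trans m≤⌊n/2⌋ (⌊n/2⌋≤⌈n/2⌉ n)))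

-- The left side is T (suc m) (suc k) at a point with head b and tail weight r, for l = m ∸ k.
threshold-split : ∀ b r k l →
  ((if b then 1 else 0) + r < suc k ⊎ l < (if b then 1 else 0) + r) ⇔
  ((if b then r ≡ l else r ≡ k) ⊎ (r < k ⊎ l < r))
threshold-split false r k l = mk⇔ to from
  where
  to : r < suc k ⊎ l < r → r ≡ k ⊎ (r < k ⊎ l < r)
  to (inj₁ r<1+k) with m<1+n⇒m<n∨m≡n r<1+k
  ... | inj₁ r<k = inj₂ (inj₁ r<k)
  ... | inj₂ r≡k = inj₁ r≡k
  to (inj₂ l<r) = inj₂ (inj₂ l<r)
  from : r ≡ k ⊎ (r < k ⊎ l < r) → r < suc k ⊎ l < r
  from (inj₁ refl)        = inj₁ (n<1+n r)
  from (inj₂ (inj₁ r<k))  = inj₁ (m<n⇒m<1+n r<k)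
  from (inj₂ (inj₂ l<r))  = inj₂ l<r
threshold-split true r k l = mk⇔ to from
  where
  to : suc r < suc k ⊎ l < suc r → r ≡ l ⊎ (r < k ⊎ l < r)
  to (inj₁ (s≤s r<k)) = inj₂ (inj₁ r<k)
  to (inj₂ l<1+r) with m<1+n⇒m<n∨m≡n l<1+r
  ... | inj₁ l<r = inj₂ (inj₂ l<r)
  ... | inj₂ l≡r = inj₁ (sym l≡r)
  from : r ≡ l ⊎ (r < k ⊎ l < r) → suc r < suc k ⊎ l < suc r
  from (inj₁ refl)        = inj₂ (n<1+n r)
  from (inj₂ (inj₁ r<k))  = inj₁ (s≤s r<k)
  from (inj₂ (inj₂ l<r))  = inj₂ (m<n⇒m<1+n l<r)

affine-root : ∀ b r d k l → d + k ≡ l →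
  ((if b then - fromℕ d else 0ℚ) +ℚ fromℕ r ≡ fromℕ k) ⇔ (if b then r ≡ l else r ≡ k)
affine-root false r d k l _ = mk⇔
  (λ e → fromℕ-injective (trans (sym (QP.+-identityˡ (fromℕ r))) e))
  (λ { refl → QP.+-identityˡ (fromℕ k) })
affine-root true r d k .(d + k) refl = mk⇔ to from
  where
  open ≡-Reasoning
  to : - fromℕ d +ℚ fromℕ r ≡ fromℕ k → r ≡ d + k
  to e = fromℕ-injective (begin
    fromℕ r                            ≡⟨ \\-leftDividesˡ (fromℕ d) (fromℕ r) ⟨
    fromℕ d +ℚ (- fromℕ d +ℚ fromℕ r)  ≡⟨ cong (fromℕ d +ℚ_) e ⟩
    fromℕ d +ℚ fromℕ k                 ≡⟨ fromℕ-+ d k ⟨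
    fromℕ (d + k)                      ∎)
  from : r ≡ d + k → - fromℕ d +ℚ fromℕ r ≡ fromℕ k
  from refl = begin
    - fromℕ d +ℚ fromℕ (d + k)         ≡⟨ cong (- fromℕ d +ℚ_) (fromℕ-+ d k) ⟩
    - fromℕ d +ℚ (fromℕ d +ℚ fromℕ k)  ≡⟨ \\-leftDividesʳ (fromℕ d) (fromℕ k) ⟩
    fromℕ k                            ∎

lift : ∀ {m} → Hyperplane m → Hyperplane (suc m)
lift H = record
  { a       = 0ℚ Vector.∷ Hyperplane.a H
  ; b       = Hyperplane.b H
  ; nonzero = λ a≡0 → Hyperplane.nonzero H (a≡0 ∘ suc)
  }

∈-lift : ∀ {m} (H : Hyperplane m) (u : Cube (suc m)) → u ∈H lift H ⇔ Vector.tail u ∈H H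
∈-lift H u = mk⇔ (trans (sym dot-lift)) (trans dot-lift)
  where
  dot-lift : dot (Hyperplane.a (lift H)) u ≡ dot (Hyperplane.a H) (Vector.tail u)
  dot-lift with u zero
  ... | true  = QP.+-identityˡ _
  ... | false = QP.+-identityˡ _

Any-lift : ∀ {m k} (Hs : Vec (Hyperplane m) k) (u : Cube (suc m)) →
  Any (u ∈H_) (map lift Hs) ⇔ Any (Vector.tail u ∈H_) Hs
Any-lift Hs u = mk⇔
  (Any.map (λ {H} → Equivalence.to (∈-lift H u)) ∘ map⁻)
  (map⁺ ∘ Any.map (λ {H} → Equivalence.from (∈-lift H u)))

pivot : ∀ {m} → ℕ → ℕ → Hyperplane (suc m)
pivot d k = record
  { a       = (- fromℕ (suc d)) Vector.∷ (λ _ → 1ℚ)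
  ; b       = fromℕ k
  ; nonzero = λ a≡0 → QP.<⇒≢ (fromℕ-suc-pos d) (sym (QP.neg-injective (a≡0 zero)))
  }

∈-pivot : ∀ {m} d k l → suc d + k ≡ l → (u : Cube (suc m)) →
  u ∈H pivot d k ⇔ (if u zero then weight (Vector.tail u) ≡ l else weight (Vector.tail u) ≡ k)
∈-pivot {m} d k l d+k≡l u = subst (λ x → (x ≡ fromℕ k) ⇔ _) (sym dot-pivot)
  (affine-root (u zero) (weight (Vector.tail u)) (suc d) k l d+k≡l)
  where
  dot-pivot : dot (Hyperplane.a (pivot {m} d k)) u
            ≡ (if u zero then - fromℕ (suc d) else 0ℚ) +ℚ fromℕ (weight (Vector.tail u))
  dot-pivot = cong ((if u zero then - fromℕ (suc d) else 0ℚ) +ℚ_) (dot-1≡weight (Vector.tail u))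

CutsOut : ∀ {n k} → Vec (Hyperplane n) k → (Cube n → Set) → Set
CutsOut {n} Hs S = (u : Cube n) → Any (u ∈H_) Hs ⇔ S u

cutsOut-step : ∀ {m k} d {Hs : Vec (Hyperplane m) k} → suc d + k ≡ m ∸ k →
  CutsOut Hs (T m k) → CutsOut (pivot d k ∷ map lift Hs) (T (suc m) (suc k))
cutsOut-step {m} {k} d {Hs} d+k≡m∸k cut u = begin
  Any (u ∈H_) (pivot d k ∷ map lift Hs)
    ↔⟨ ∷↔ (u ∈H_) ⟨
  (u ∈H pivot d k ⊎ Any (u ∈H_) (map lift Hs))
    ∼⟨ ∈-pivot d k (m ∸ k) d+k≡m∸k u ⊎-⇔ Any-lift Hs u ⟩
  ((if u zero then weight v ≡ m ∸ k else weight v ≡ k) ⊎ Any (v ∈H_) Hs)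
    ∼⟨ ⇔-id _ ⊎-⇔ cut v ⟩
  ((if u zero then weight v ≡ m ∸ k else weight v ≡ k) ⊎ T m k v)
    ∼⟨ ⇔-sym (threshold-split (u zero) (weight v) k (m ∸ k)) ⟩
  T (suc m) (suc k) u
    ∎
  where
  open EquationalReasoning
  v : Cube m
  v = Vector.tail u

T-cutOut : ∀ k n → k + k ≤ n → Σ (Vec (Hyperplane n) k) (λ Hs → CutsOut Hs (T n k))
T-cutOut zero    n       _ = [] , λ u → mk⇔ (λ ()) (⊥-elim ∘ T-zero-empty u)
T-cutOut (suc k) (suc m) (s≤s k+1+k≤m) with T-cutOut k m (≤-trans (+-monoʳ-≤ k (n≤1+n k)) k+1+k≤m)
... | Hs , cut = pivot d k ∷ map lift Hs , cutsOut-step d d+k≡m∸k cut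
  where
  d : ℕ
  d = m ∸ k ∸ suc k
  d+k≡m∸k : suc d + k ≡ m ∸ k
  d+k≡m∸k = trans (sym (+-suc d k))
    (m∸n+n≡m (m+n≤o⇒m≤o∸n (suc k) (subst (_≤ m) (+-comm k (suc k)) k+1+k≤m)))

lemma3p10 : (n ℓ : ℕ) → 2 ≤ n → 1 ≤ ℓ → ℓ ≤ ⌊ n /2⌋ →
    Σ (Vec (Hyperplane n) ℓ) (λ Hs →
    (u : Cube n) → (Any (λ H → u ∈H H) Hs → T n ℓ u) × (T n ℓ u → Any (λ H → u ∈H H) Hs))
lemma3p10 n ℓ _ _ ℓ≤⌊n/2⌋ with T-cutOut ℓ n (m≤⌊n/2⌋⇒m+m≤n ℓ≤⌊n/2⌋)
... | Hs , cut = Hs , λ u → Equivalence.to (cut u) , Equivalence.from (cut u)
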